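{- Let $a<b$ be positive integers, $S_L=\{a\}$ and $S_R=\{b\}$. The outcome sequence of the game $(S_L,S_R)$ is purely periodic with period length $a+b$, and its period is $\mathcal P^a\mathcal L^{b-a}\mathcal N^a$; that is, for all $n\ge0$, $o(n+a+b)=o(n)$, and $o(n)=\mathcal P$ for $0\le n<a$, $o(n)=\mathcal L$ for $a\le n<b$, $o(n)=\mathcal N$ for $b\le n<a+b$. In particular, the game is weakly dominating for Left.
   Context: A partizan subtraction game $(S_L,S_R)$, with $S_L,S_R$ finite sets of positive integers, is played on a heap of $n$ tokens. Two players, Left and Right, alternate moves; Left removes $s\in S_L$ tokens and Right removes $s\in S_R$ tokens (at most the current heap size). A player unable to move loses. The outcome $o(n)$ is $\mathcal L$ (Left wins whoever starts), $\mathcal R$ (Right wins whoever starts), $\mathcal N$ (first player wins) or $\mathcal P$ (second player wins). The game is weakly dominating for Left if the period of the outcome sequence contains at least one $\mathcal L$ and no $\mathcal R$. -}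

module Defs where

open import Data.Nat using (ℕ; zero; suc; _+_; _∸_; _≤ᵇ_; _<_; _≤_)
open import Data.Bool using (Bool; true; false; not; _∧_)
open import Data.List using (List)
open import Data.Bool.ListAction using (any)
open import Data.Product using (Σ; _×_; ∃)
open import Relation.Binary.PropositionalEquality using (_≡_; _≢_)

data Outcome : Set where
  𝓛 𝓡 𝓝 𝓟 : Outcome

-- The first ℕ argument is fuel (structural recursion);
-- fuel n+1 suffices at heap n since every move removes ≥ 1 token.
-- leftFirstWins f n : Left, moving first on a heap of n, has a winning strategy.
mutual
  leftFirstWins : List ℕ → List ℕ → ℕ → ℕ → Bool
  leftFirstWins SL SR zero    n = false
  leftFirstWins SL SR (suc f) n =
    any (λ s → (s ≤ᵇ n) ∧ not (rightFirstWins SL SR f (n ∸ s))) SL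

  rightFirstWins : List ℕ → List ℕ → ℕ → ℕ → Bool
  rightFirstWins SL SR zero    n = false
  rightFirstWins SL SR (suc f) n =
    any (λ s → (s ≤ᵇ n) ∧ not (leftFirstWins SL SR f (n ∸ s))) SR

classify : Bool → Bool → Outcome
classify true  true  = 𝓝
classify true  false = 𝓛
classify false true  = 𝓡
classify false false = 𝓟

outcome : List ℕ → List ℕ → ℕ → Outcome
outcome SL SR n =
  classify (leftFirstWins SL SR (suc n) n) (rightFirstWins SL SR (suc n) n)

WeaklyDominatingLeft : List ℕ → List ℕ → Set
WeaklyDominatingLeft SL SR =
  Σ ℕ λ n₀ → Σ ℕ λ p → 0 < p
    × (∀ n → n₀ ≤ n → outcome SL SR (n + p) ≡ outcome SL SR n)
    × (∃ λ i → i < p × outcome SL SR (n₀ + i) ≡ 𝓛)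
    × (∀ i → i < p → outcome SL SR (n₀ + i) ≢ 𝓡)

{-# OPTIONS --safe #-}
module Submission where

-- With r = n mod (a + b), the player removing a wins moving first from n iff a ≤ r.
-- Indeed, if a ≤ r the move leaves residue r − a < b, from which the opponent
-- (removing b) loses moving first; if r < a ≤ n it leaves residue r + b ≥ b, a win
-- for the opponent. Exchanging the two subtraction sets exchanges the players, so a
-- single induction on the heap covers Left and Right at once. Hence o(n) depends only
-- on r, and reading it off for r < a, a ≤ r < b and b ≤ r gives 𝓟, 𝓛 and 𝓝.

open import Defs
open import Data.Nat using (ℕ; zero; suc; _+_; _*_; _∸_; _≤ᵇ_; _<_; _≤_; _≤?_; s≤s; NonZero; >-nonZero; >-nonZero⁻¹)
open import Data.Nat.Properties
open import Data.Nat.DivMod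
open import Data.Bool using (Bool; true; false; not; _∧_; _∨_)
open import Data.Bool.Properties using (∨-identityʳ; not-involutive)
open import Data.List using ([_])
open import Data.Bool.ListAction using (any; or)
open import Data.List.Properties using (map-cong)
open import Data.Product using (_×_; _,_)
open import Relation.Binary.PropositionalEquality hiding ([_])
open import Relation.Nullary using (yes; no; contradiction)
open import Relation.Nullary.Decidable using (dec-true; dec-false)

+-nonZeroˡ : ∀ {m n} → .{{NonZero m}} → NonZero (m + n)
+-nonZeroˡ {suc m} = _

≤ᵇ-true : ∀ {m n} → m ≤ n → (m ≤ᵇ n) ≡ true
≤ᵇ-true {m} {n} = dec-true (m ≤? n)

≤ᵇ-false : ∀ {m n} → n < m → (m ≤ᵇ n) ≡ false
≤ᵇ-false {m} {n} n<m = dec-false (m ≤? n) (<⇒≱ n<m)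

[r+kd]%d≡r : ∀ r k d .{{_ : NonZero d}} → r < d → (r + k * d) % d ≡ r
[r+kd]%d≡r r k d r<d = trans ([m+kn]%n≡m%n r k d) (m<n⇒m%n≡m r<d)

[m∸n]%d≡m%d∸n : ∀ m n d .{{_ : NonZero d}} → n ≤ m % d → (m ∸ n) % d ≡ m % d ∸ n
[m∸n]%d≡m%d∸n m n d n≤r = begin
  (m ∸ n) % d                       ≡⟨ cong (λ x → (x ∸ n) % d) (m≡m%n+[m/n]*n m d) ⟩
  (m % d + m / d * d ∸ n) % d       ≡⟨ cong (_% d) (+-∸-comm (m / d * d) n≤r) ⟩
  (m % d ∸ n + m / d * d) % d       ≡⟨ [r+kd]%d≡r (m % d ∸ n) (m / d) d r∸n<d ⟩
  m % d ∸ n                         ∎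
  where
  open ≡-Reasoning
  r∸n<d : m % d ∸ n < d
  r∸n<d = ≤-<-trans (m∸n≤m (m % d) n) (m%n<n m d)

[m∸n]%d≡m%d+[d∸n] : ∀ m n d .{{_ : NonZero d}} → n ≤ d → n ≤ m → m % d < n →
  (m ∸ n) % d ≡ m % d + (d ∸ n)
[m∸n]%d≡m%d+[d∸n] m n d n≤d n≤m r<n with m / d | m≡m%n+[m/n]*n m d
... | zero  | m≡r+0 = contradiction (subst (_< n) (sym (trans m≡r+0 (+-identityʳ _))) r<n) (≤⇒≯ n≤m)
... | suc k | m≡r+d+kd = begin
  (m ∸ n) % d                   ≡⟨ cong (λ x → (x ∸ n) % d) m≡r+d+kd ⟩
  (r + (d + k * d) ∸ n) % d     ≡⟨ cong (_% d) (+-∸-assoc r (≤-trans n≤d (m≤m+n d (k * d)))) ⟩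
  (r + (d + k * d ∸ n)) % d     ≡⟨ cong (λ x → (r + x) % d) (+-∸-comm (k * d) n≤d) ⟩
  (r + (d ∸ n + k * d)) % d     ≡⟨ cong (_% d) (sym (+-assoc r (d ∸ n) (k * d))) ⟩
  (r + (d ∸ n) + k * d) % d     ≡⟨ [r+kd]%d≡r (r + (d ∸ n)) k d r+[d∸n]<d ⟩
  r + (d ∸ n)                   ∎
  where
  open ≡-Reasoning
  r : ℕ
  r = m % d
  r+[d∸n]<d : r + (d ∸ n) < d
  r+[d∸n]<d = subst (r + (d ∸ n) <_) (m+[n∸m]≡n n≤d) (+-monoˡ-< (d ∸ n) r<n)

any-cong : ∀ {A : Set} {p q : A → Bool} → (∀ x → p x ≡ q x) → ∀ xs → any p xs ≡ any q xs
any-cong p≗q xs = cong or (map-cong p≗q xs)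

leftFirstWins-swap : ∀ SL SR f n → leftFirstWins SL SR f n ≡ rightFirstWins SR SL f n
leftFirstWins-swap SL SR zero    n = refl
leftFirstWins-swap SL SR (suc f) n =
  any-cong (λ s → cong (λ w → (s ≤ᵇ n) ∧ not w) (sym (leftFirstWins-swap SR SL f (n ∸ s)))) SL

rightFirstWins-swap : ∀ SL SR f n → rightFirstWins SL SR f n ≡ leftFirstWins SR SL f n
rightFirstWins-swap SL SR f n = sym (leftFirstWins-swap SR SL f n)

firstMoverWins : (a b : ℕ) .{{_ : NonZero a}} → ℕ → Bool
firstMoverWins a b n = a ≤ᵇ n % (a + b)
  where instance a+b-nonZero : NonZero (a + b)
                 a+b-nonZero = +-nonZeroˡ

module _ (a b : ℕ) .{{_ : NonZero a}} .{{_ : NonZero b}} where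

  private instance
    a+b-nonZero : NonZero (a + b)
    a+b-nonZero = +-nonZeroˡ
    b+a-nonZero : NonZero (b + a)
    b+a-nonZero = +-nonZeroˡ

  firstMoverWins-< : ∀ {n} → n < a → firstMoverWins a b n ≡ false
  firstMoverWins-< {n} n<a = ≤ᵇ-false (≤-<-trans (m%n≤m n (a + b)) n<a)

  firstMoverWins-∸ : ∀ {n} → a ≤ n → firstMoverWins b a (n ∸ a) ≡ not (firstMoverWins a b n)
  firstMoverWins-∸ {n} a≤n with a ≤? n % (a + b)
  ... | yes a≤r = begin
    b ≤ᵇ (n ∸ a) % (b + a) ≡⟨ cong (b ≤ᵇ_) (%-congʳ (+-comm b a)) ⟩
    b ≤ᵇ (n ∸ a) % (a + b) ≡⟨ cong (b ≤ᵇ_) ([m∸n]%d≡m%d∸n n a (a + b) a≤r) ⟩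
    b ≤ᵇ n % (a + b) ∸ a   ≡⟨ ≤ᵇ-false (m<n+o⇒m∸n<o (n % (a + b)) a (m%n<n n (a + b))) ⟩
    false                  ≡⟨ cong not (sym (≤ᵇ-true a≤r)) ⟩
    not (a ≤ᵇ n % (a + b)) ∎
    where open ≡-Reasoning
  ... | no a≰r = begin
    b ≤ᵇ (n ∸ a) % (b + a) ≡⟨ cong (b ≤ᵇ_) (%-congʳ (+-comm b a)) ⟩
    b ≤ᵇ (n ∸ a) % (a + b) ≡⟨ cong (b ≤ᵇ_) ([m∸n]%d≡m%d+[d∸n] n a (a + b) (m≤m+n a b) a≤n (≰⇒> a≰r)) ⟩
    b ≤ᵇ n % (a + b) + (a + b ∸ a) ≡⟨ cong (λ x → b ≤ᵇ n % (a + b) + x) (m+n∸m≡n a b) ⟩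
    b ≤ᵇ n % (a + b) + b   ≡⟨ ≤ᵇ-true (m≤n+m b _) ⟩
    true                   ≡⟨ cong not (sym (≤ᵇ-false (≰⇒> a≰r))) ⟩
    not (a ≤ᵇ n % (a + b)) ∎
    where open ≡-Reasoning

leftFirstWins-singletons : ∀ a b .{{_ : NonZero a}} .{{_ : NonZero b}} f n → n < f →
  leftFirstWins [ a ] [ b ] f n ≡ firstMoverWins a b n
leftFirstWins-singletons a b (suc f) n (s≤s n≤f) with a ≤? n
... | yes a≤n = begin
  ((a ≤ᵇ n) ∧ not (rightFirstWins [ a ] [ b ] f (n ∸ a))) ∨ false
    ≡⟨ ∨-identityʳ _ ⟩
  (a ≤ᵇ n) ∧ not (rightFirstWins [ a ] [ b ] f (n ∸ a))
    ≡⟨ cong₂ (λ x w → x ∧ not w) (≤ᵇ-true a≤n) (trans (rightFirstWins-swap [ a ] [ b ] f (n ∸ a)) reply) ⟩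
  not (firstMoverWins b a (n ∸ a))
    ≡⟨ cong not (firstMoverWins-∸ a b a≤n) ⟩
  not (not (firstMoverWins a b n))
    ≡⟨ not-involutive _ ⟩
  firstMoverWins a b n ∎
  where
  open ≡-Reasoning
  reply : leftFirstWins [ b ] [ a ] f (n ∸ a) ≡ firstMoverWins b a (n ∸ a)
  reply = leftFirstWins-singletons b a f (n ∸ a)
            (<-≤-trans (∸-monoʳ-< (>-nonZero⁻¹ a) a≤n) n≤f)
... | no a≰n =
  trans (cong (λ x → (x ∧ not (rightFirstWins [ a ] [ b ] f (n ∸ a))) ∨ false) (≤ᵇ-false (≰⇒> a≰n)))
        (sym (firstMoverWins-< a b (≰⇒> a≰n)))

rightFirstWins-singletons : ∀ a b .{{_ : NonZero a}} .{{_ : NonZero b}} f n → n < f →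
  rightFirstWins [ a ] [ b ] f n ≡ firstMoverWins b a n
rightFirstWins-singletons a b f n n<f =
  trans (rightFirstWins-swap [ a ] [ b ] f n) (leftFirstWins-singletons b a f n n<f)

module _ (a b : ℕ) .{{_ : NonZero a}} .{{_ : NonZero b}} where

  private instance
    a+b-nonZero : NonZero (a + b)
    a+b-nonZero = +-nonZeroˡ
    b+a-nonZero : NonZero (b + a)
    b+a-nonZero = +-nonZeroˡ

  outcome-singletons : ∀ n → outcome [ a ] [ b ] n ≡ classify (a ≤ᵇ n % (a + b)) (b ≤ᵇ n % (a + b))
  outcome-singletons n = cong₂ classify
    (leftFirstWins-singletons a b (suc n) n ≤-refl)
    (trans (rightFirstWins-singletons a b (suc n) n ≤-refl) (cong (b ≤ᵇ_) (%-congʳ (+-comm b a))))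

  outcome-periodic : ∀ n → outcome [ a ] [ b ] (n + (a + b)) ≡ outcome [ a ] [ b ] n
  outcome-periodic n = begin
    outcome [ a ] [ b ] (n + (a + b))         ≡⟨ outcome-singletons (n + (a + b)) ⟩
    classifyResidue ((n + (a + b)) % (a + b)) ≡⟨ cong classifyResidue ([m+n]%n≡m%n n (a + b)) ⟩
    classifyResidue (n % (a + b))             ≡⟨ sym (outcome-singletons n) ⟩
    outcome [ a ] [ b ] n                     ∎
    where
    open ≡-Reasoning
    classifyResidue : ℕ → Outcome
    classifyResidue r = classify (a ≤ᵇ r) (b ≤ᵇ r)

  outcome-firstPeriod : ∀ {n} → n < a + b → outcome [ a ] [ b ] n ≡ classify (a ≤ᵇ n) (b ≤ᵇ n)
  outcome-firstPeriod {n} n<a+b =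
    trans (outcome-singletons n) (cong (λ r → classify (a ≤ᵇ r) (b ≤ᵇ r)) (m<n⇒m%n≡m n<a+b))

  outcome-𝓟 : ∀ {n} → n < a → n < b → outcome [ a ] [ b ] n ≡ 𝓟
  outcome-𝓟 n<a n<b rewrite outcome-firstPeriod (<-≤-trans n<a (m≤m+n a b))
    | ≤ᵇ-false n<a | ≤ᵇ-false n<b = refl

  outcome-𝓛 : ∀ {n} → a ≤ n → n < b → outcome [ a ] [ b ] n ≡ 𝓛
  outcome-𝓛 a≤n n<b rewrite outcome-firstPeriod (<-≤-trans n<b (m≤n+m b a))
    | ≤ᵇ-true a≤n | ≤ᵇ-false n<b = refl

  outcome-𝓝 : ∀ {n} → a ≤ n → b ≤ n → n < a + b → outcome [ a ] [ b ] n ≡ 𝓝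
  outcome-𝓝 a≤n b≤n n<a+b rewrite outcome-firstPeriod n<a+b
    | ≤ᵇ-true a≤n | ≤ᵇ-true b≤n = refl

  outcome-≢𝓡 : a ≤ b → ∀ n → outcome [ a ] [ b ] n ≢ 𝓡
  outcome-≢𝓡 a≤b n rewrite outcome-singletons n with b ≤? n % (a + b)
  ... | yes b≤r rewrite ≤ᵇ-true b≤r | ≤ᵇ-true (≤-trans a≤b b≤r) = λ ()
  ... | no b≰r rewrite ≤ᵇ-false (≰⇒> b≰r) with a ≤ᵇ n % (a + b)
  ...   | true  = λ ()
  ...   | false = λ ()

mainTheorem9 : (a b : ℕ) → 0 < a → a < b →
    (∀ n → outcome [ a ] [ b ] (n + (a + b)) ≡ outcome [ a ] [ b ] n)
    × (∀ n → n < a → outcome [ a ] [ b ] n ≡ 𝓟)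
    × (∀ n → a ≤ n → n < b → outcome [ a ] [ b ] n ≡ 𝓛)
    × (∀ n → b ≤ n → n < a + b → outcome [ a ] [ b ] n ≡ 𝓝)
    × WeaklyDominatingLeft [ a ] [ b ]
mainTheorem9 a b 0<a a<b =
  outcome-periodic a b ,
  (λ _ n<a → outcome-𝓟 a b n<a (<-trans n<a a<b)) ,
  (λ _ → outcome-𝓛 a b) ,
  (λ _ b≤n → outcome-𝓝 a b (≤-trans (<⇒≤ a<b) b≤n) b≤n) ,
  (0 , a + b , <-≤-trans 0<a (m≤m+n a b) , (λ n _ → outcome-periodic a b n) ,
   (a , m<m+n a 0<b , outcome-𝓛 a b ≤-refl a<b) , (λ i _ → outcome-≢𝓡 a b (<⇒≤ a<b) i))
  where
  0<b : 0 < b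
  0<b = <-trans 0<a a<b
  instance
    a-nonZero : NonZero a
    a-nonZero = >-nonZero 0<a
    b-nonZero : NonZero b
    b-nonZero = >-nonZero 0<b
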